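{- Spiders are reconstructible: if $G$ is a spider with $|V(G)|\ge 3$ and $H$ is a graph for which there is a bijection $f:V(G)\to V(H)$ with $G-v\cong H-f(v)$ for all $v\in V(G)$, then $H\cong G$.
   Context: All graphs are finite and simple. A graph $G$ is split if $V(G)$ can be partitioned into a clique $A$ and a stable set $B$. A split graph $G$ with such a partition $(A,B)$ is a spider if there is a bijection $f:B\to A$ such that either $N(b)=\{f(b)\}$ for every $b\in B$ (thin spider), or $N(b)=A\setminus\{f(b)\}$ for every $b\in B$ (thick spider). Here $N(b)$ is the neighbourhood of $b$. -}

module Defs where

open import Data.Nat using (ℕ; suc)
open import Data.Fin using (Fin; punchIn)
open import Data.Bool using (Bool; true; false)
open import Data.Product using (Σ; _×_; proj₁)
open import Relation.Binary.PropositionalEquality using (_≡_; _≢_)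
open import Relation.Nullary using (¬_)
open import Function.Bundles using (_⤖_; Bijection; _⇔_)

record Graph (n : ℕ) : Set where
  field
    Adj    : Fin n → Fin n → Bool
    sym    : ∀ x y → Adj x y ≡ Adj y x
    irrefl : ∀ x → Adj x x ≡ false
open Graph public

record _≅_ {n m : ℕ} (G : Graph n) (H : Graph m) : Set where
  field
    iso      : Fin n ⤖ Fin m
    preserve : ∀ x y → Adj G x y ≡ Adj H (Bijection.to iso x) (Bijection.to iso y)

_─_ : ∀ {n} → Graph (suc n) → Fin (suc n) → Graph n
Adj    (G ─ v) x y = Adj G (punchIn v x) (punchIn v y)
sym    (G ─ v) x y = sym G (punchIn v x) (punchIn v y)
irrefl (G ─ v) x   = irrefl G (punchIn v x)

-- A split partition is given by the indicator inA : V → Bool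
-- (A = {v | inA v ≡ true} a clique, B = {v | inA v ≡ false} a stable set).
module _ {n : ℕ} (G : Graph n) (inA : Fin n → Bool) where

  Aset : Set
  Aset = Σ (Fin n) (λ v → inA v ≡ true)

  Bset : Set
  Bset = Σ (Fin n) (λ v → inA v ≡ false)

  IsClique : Set
  IsClique = (a a' : Aset) → proj₁ a ≢ proj₁ a' → Adj G (proj₁ a) (proj₁ a') ≡ true

  IsStable : Set
  IsStable = (b b' : Bset) → Adj G (proj₁ b) (proj₁ b') ≡ false

  IsSplitPartition : Set
  IsSplitPartition = IsClique × IsStable

  ThinLegs : (Bset ⤖ Aset) → Set
  ThinLegs f = (b : Bset) (v : Fin n) →
    (Adj G (proj₁ b) v ≡ true) ⇔ (v ≡ proj₁ (Bijection.to f b))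

  ThickLegs : (Bset ⤖ Aset) → Set
  ThickLegs f = (b : Bset) (v : Fin n) →
    (Adj G (proj₁ b) v ≡ true) ⇔ ((inA v ≡ true) × (v ≢ proj₁ (Bijection.to f b)))

data Spider {n : ℕ} (G : Graph n) : Set where
  thin  : (inA : Fin n → Bool) → IsSplitPartition G inA →
          (f : Bset G inA ⤖ Aset G inA) → ThinLegs G inA f → Spider G
  thick : (inA : Fin n → Bool) → IsSplitPartition G inA →
          (f : Bset G inA ⤖ Aset G inA) → ThickLegs G inA f → Spider G

module Submission where

-- By Kelly's lemma the deck determines every degree: deg H (f v) =
-- deg G v.  A card isomorphism g : G - v ≃ H - f v extends to G ≃ H as soon as
-- it respects adjacency to the deleted vertex, and it does so at every
-- survivor y whose adjacency to v is readable from its degree: the image of y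
-- has degree [w ~ g y] + deg_{G-v} y, and this must be a degree of G.
--   * In a thin spider all degrees are 1 (legs) or |A| (body).  Unless |A| = 2
--     no two degrees differ by one, so every card isomorphism extends.
--   * For |A| = 2 the spider is the path b₁ v a₂ b₂.  At v only b₁ is read off
--     its degree, but a₂, b₂ are twins in G - v: either the card isomorphism or
--     its composite with the swap a₂ ↔ b₂ matches at all but one survivor, and
--     counting the degree of v settles the last one.
--   * The complement of a thick spider is a thin spider, and complementation
--     commutes with deleting vertices, so thick spiders reduce to thin ones.

open import Defs renaming (sym to adj-sym; irrefl to adj-irrefl)
open import Data.Nat using (ℕ; zero; suc; _+_; _*_; _≤_; s≤s; z≤n)
import Data.Nat as Nat
open import Data.Nat.Properties
  using (+-0-commutativeMonoid; +-comm; +-assoc; +-identityʳ; +-cancelʳ-≡; +-cancelˡ-≡;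
         *-cancelˡ-≡; *-zeroʳ; m+n≡0⇒m≡0; suc-injective; 1+n≢n; 1+n≢0)
open import Data.Fin using (Fin; zero; suc; punchIn; punchOut; _≟_)
open import Data.Fin.Properties using (punchInᵢ≢i; punchIn-injective; punchIn-punchOut)
open import Data.Fin.Permutation
  using (Permutation; _⟨$⟩ʳ_; _⟨$⟩ˡ_; inverseˡ; inverseʳ; flip; _∘ₚ_; insert; insert-punchIn; transpose; ↔⇒≡)
open import Data.Bool using (Bool; true; false; not; if_then_else_)
import Data.Bool.Properties as Bool
open import Data.Product using (_×_; _,_; proj₁; proj₂; ∃)
open import Data.Sum using (_⊎_; inj₁; inj₂)
open import Data.Empty using (⊥-elim)
open import Function using (_∘_)
open import Relation.Nullary using (does; yes; no)
open import Relation.Nullary.Decidable using (dec-true; dec-false; does-⇔)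
open import Relation.Binary.PropositionalEquality
  using (_≡_; _≢_; refl; sym; trans; cong; cong₂; subst; module ≡-Reasoning)
open import Function.Bundles using (Bijection; Inverse; Equivalence; _⇔_; _⤖_; mk⇔)
open import Function.Properties.Bijection using (⤖⇒↔)
open import Function.Properties.Inverse using (↔⇒⤖)
import Algebra.Properties.CommutativeMonoid.Sum as MonoidSum
import Data.Fin.Permutation as Perm

open MonoidSum +-0-commutativeMonoid
  using (sum-remove; sum-permute) renaming (sum to ∑; sum-cong-≗ to ∑-cong; ∑-distrib-+ to ∑-+)

private
  variable
    n m : ℕ

ι : Bool → ℕ
ι true  = 1
ι false = 0

ι-injective : ∀ {a b} → ι a ≡ ι b → a ≡ b
ι-injective {true}  {true}  _ = refl
ι-injective {false} {false} _ = refl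

true≢false : true ≢ false
true≢false ()

_≡ᵇ_ : Fin n → Fin n → Bool
x ≡ᵇ y = does (x ≟ y)

≡ᵇ-refl : (x : Fin n) → (x ≡ᵇ x) ≡ true
≡ᵇ-refl x = dec-true (x ≟ x) refl

≡ᵇ-≢ : {x y : Fin n} → x ≢ y → (x ≡ᵇ y) ≡ false
≡ᵇ-≢ {x = x} {y} = dec-false (x ≟ y)

≡ᵇ-⇔ : {x y : Fin n} {x′ y′ : Fin m} → (x ≡ y → x′ ≡ y′) → (x′ ≡ y′ → x ≡ y) →
       (x ≡ᵇ y) ≡ (x′ ≡ᵇ y′)
≡ᵇ-⇔ {x = x} {y} {x′} {y′} to from = does-⇔ (mk⇔ to from) (x ≟ y) (x′ ≟ y′)

∑-remove : (i : Fin (suc n)) (f : Fin (suc n) → ℕ) → ∑ f ≡ f i + ∑ (λ x → f (punchIn i x))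
∑-remove i f = sum-remove {i = i} f

∑-permute : (π : Permutation m n) (f : Fin n → ℕ) → ∑ f ≡ ∑ (λ x → f (π ⟨$⟩ʳ x))
∑-permute π f = sum-permute f π

∑-const : ∀ n (c : ℕ) → ∑ {n} (λ _ → c) ≡ n * c
∑-const zero    c = refl
∑-const (suc n) c = cong (c +_) (∑-const n c)

∑-zero : (f : Fin n → ℕ) → (∀ i → f i ≡ 0) → ∑ f ≡ 0
∑-zero {n} f f≡0 = trans (∑-cong f≡0) (trans (∑-const n 0) (*-zeroʳ n))

∑≡0⇒≡0 : (f : Fin n → ℕ) → ∑ f ≡ 0 → ∀ i → f i ≡ 0
∑≡0⇒≡0 {suc n} f ∑f≡0 i = m+n≡0⇒m≡0 (f i) (trans (sym (∑-remove i f)) ∑f≡0)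

∑-point : (c : Fin n) → ∑ (λ y → ι (y ≡ᵇ c)) ≡ 1
∑-point {suc n} c = begin
  ∑ (λ y → ι (y ≡ᵇ c))                                ≡⟨ ∑-remove c (λ y → ι (y ≡ᵇ c)) ⟩
  ι (c ≡ᵇ c) + ∑ (λ x → ι (punchIn c x ≡ᵇ c))         ≡⟨ cong₂ _+_ (cong ι (≡ᵇ-refl c)) off-c ⟩
  1                                                    ∎
  where
  open ≡-Reasoning
  off-c : ∑ (λ x → ι (punchIn c x ≡ᵇ c)) ≡ 0
  off-c = ∑-zero _ (λ x → cong ι (≡ᵇ-≢ (punchInᵢ≢i c x)))

∑ι≡1⇒unique : (P : Fin n → Bool) → ∑ (λ y → ι (P y)) ≡ 1 →
              ∃ λ a → P a ≡ true × (∀ y → P y ≡ true → y ≡ a)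
∑ι≡1⇒unique {suc n} P ∑≡1 with P zero in P₀
... | true  = zero , P₀ , only-zero
  where
  rest≡0 : ∀ y → ι (P (suc y)) ≡ 0
  rest≡0 = ∑≡0⇒≡0 (λ y → ι (P (suc y))) (suc-injective ∑≡1)
  only-zero : ∀ y → P y ≡ true → y ≡ zero
  only-zero zero    _  = refl
  only-zero (suc y) Py with () ← trans (cong ι (sym Py)) (rest≡0 y)
... | false with ∑ι≡1⇒unique (λ y → P (suc y)) ∑≡1
...   | a , Pa , unique = suc a , Pa , only-a
  where
  only-a : ∀ y → P y ≡ true → y ≡ suc a
  only-a zero    Py with () ← trans (sym Py) P₀
  only-a (suc y) Py = cong suc (unique y Py)

-- An isomorphism whose vertex map is a permutation, so that inverses and
-- composites are available directly.
record _≃_ (G : Graph n) (H : Graph m) : Set where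
  field
    perm : Permutation n m
    adj  : ∀ x y → Adj G x y ≡ Adj H (perm ⟨$⟩ʳ x) (perm ⟨$⟩ʳ y)
open _≃_

≃-sym : {G : Graph n} {H : Graph m} → G ≃ H → H ≃ G
≃-sym {G = G} {H} g = record { perm = flip (perm g) ; adj = adj′ }
  where
  adj′ : ∀ x y → Adj H x y ≡ Adj G (perm g ⟨$⟩ˡ x) (perm g ⟨$⟩ˡ y)
  adj′ x y = sym (trans (adj g _ _) (cong₂ (Adj H) (inverseʳ (perm g)) (inverseʳ (perm g))))

≃-trans : ∀ {k} {G : Graph n} {H : Graph m} {K : Graph k} → G ≃ H → H ≃ K → G ≃ K
≃-trans g h = record { perm = perm g ∘ₚ perm h ; adj = λ x y → trans (adj g x y) (adj h _ _) }

≅⇒≃ : {G : Graph n} {H : Graph m} → G ≅ H → G ≃ H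
≅⇒≃ g = record { perm = ⤖⇒↔ (_≅_.iso g) ; adj = _≅_.preserve g }

≃⇒≅ : {G : Graph n} {H : Graph m} → G ≃ H → G ≅ H
≃⇒≅ g = record { iso = ↔⇒⤖ (perm g) ; preserve = adj g }

deg : Graph n → Fin n → ℕ
deg G x = ∑ (λ y → ι (Adj G x y))

degSum : Graph n → ℕ
degSum G = ∑ (deg G)

deg-≃ : {G : Graph n} {H : Graph m} (g : G ≃ H) (x : Fin n) → deg H (perm g ⟨$⟩ʳ x) ≡ deg G x
deg-≃ g x = trans (∑-permute (perm g) _) (∑-cong (λ y → cong ι (sym (adj g x y))))

degSum-≃ : {G : Graph n} {H : Graph m} → G ≃ H → degSum H ≡ degSum G
degSum-≃ g = trans (∑-permute (perm g) _) (∑-cong (deg-≃ g))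

deg-survivor : (G : Graph (suc n)) (v : Fin (suc n)) (x : Fin n) →
               deg G (punchIn v x) ≡ ι (Adj G v (punchIn v x)) + deg (G ─ v) x
deg-survivor G v x = trans (∑-remove v (λ y → ι (Adj G (punchIn v x) y)))
                           (cong (λ b → ι b + deg (G ─ v) x) (adj-sym G (punchIn v x) v))

deg-of-deleted : (G : Graph (suc n)) (v : Fin (suc n)) → deg G v ≡ ∑ (λ x → ι (Adj G v (punchIn v x)))
deg-of-deleted G v = trans (∑-remove v (λ y → ι (Adj G v y)))
                            (cong (λ b → ι b + ∑ (λ x → ι (Adj G v (punchIn v x)))) (adj-irrefl G v))

degSum-delete : (G : Graph (suc n)) (v : Fin (suc n)) → degSum G ≡ degSum (G ─ v) + (deg G v + deg G v)
degSum-delete G v = begin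
  degSum G                                                       ≡⟨ ∑-remove v (deg G) ⟩
  deg G v + ∑ (λ x → deg G (punchIn v x))                        ≡⟨ cong (deg G v +_) survivors ⟩
  deg G v + (deg G v + degSum (G ─ v))                           ≡⟨ +-comm (deg G v) _ ⟩
  (deg G v + degSum (G ─ v)) + deg G v                           ≡⟨ cong (_+ deg G v) (+-comm (deg G v) _) ⟩
  degSum (G ─ v) + deg G v + deg G v                             ≡⟨ +-assoc (degSum (G ─ v)) _ _ ⟩
  degSum (G ─ v) + (deg G v + deg G v)                           ∎
  where
  open ≡-Reasoning
  survivors : ∑ (λ x → deg G (punchIn v x)) ≡ deg G v + degSum (G ─ v)
  survivors = begin
    ∑ (λ x → deg G (punchIn v x))                                ≡⟨ ∑-cong (deg-survivor G v) ⟩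
    ∑ (λ x → ι (Adj G v (punchIn v x)) + deg (G ─ v) x)          ≡⟨ ∑-+ (λ x → ι (Adj G v (punchIn v x))) (deg (G ─ v)) ⟩
    ∑ (λ x → ι (Adj G v (punchIn v x))) + degSum (G ─ v)         ≡⟨ cong (_+ degSum (G ─ v)) (sym (deg-of-deleted G v)) ⟩
    deg G v + degSum (G ─ v)                                     ∎

-- Summing the degree sums of all cards counts every edge N - 2 times,
-- where N = 3 + k is the number of vertices.
∑-cards : ∀ {k} (K : Graph (3 + k)) → suc k * degSum K ≡ ∑ (λ v → degSum (K ─ v))
∑-cards {k} K = +-cancelʳ-≡ (s + s) _ _ (begin
  suc k * s + (s + s)                                   ≡⟨ +-comm (suc k * s) (s + s) ⟩
  (s + s) + suc k * s                                   ≡⟨ +-assoc s s _ ⟩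
  (3 + k) * s                                           ≡⟨ ∑-const (3 + k) s ⟨
  ∑ {3 + k} (λ _ → s)                                   ≡⟨ ∑-cong (degSum-delete K) ⟩
  ∑ (λ v → degSum (K ─ v) + (deg K v + deg K v))        ≡⟨ ∑-+ (λ v → degSum (K ─ v)) (λ v → deg K v + deg K v) ⟩
  ∑ (λ v → degSum (K ─ v)) + ∑ (λ v → deg K v + deg K v) ≡⟨ cong (∑ (λ v → degSum (K ─ v)) +_) (∑-+ (deg K) (deg K)) ⟩
  ∑ (λ v → degSum (K ─ v)) + (s + s)                    ∎)
  where
  open ≡-Reasoning
  s = degSum K

module Kelly {k : ℕ} (G H : Graph (3 + k)) (f : Permutation (3 + k) (3 + k))
             (deck : ∀ v → (G ─ v) ≃ (H ─ (f ⟨$⟩ʳ v))) where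

  -- Both sides of ∑-cards agree, via f and the card isomorphisms; then
  -- cancel the factor N - 2 ≥ 1.
  degSum-preserved : degSum H ≡ degSum G
  degSum-preserved = *-cancelˡ-≡ _ _ (suc k) (begin
    suc k * degSum H                        ≡⟨ ∑-cards H ⟩
    ∑ (λ u → degSum (H ─ u))                ≡⟨ ∑-permute f (λ u → degSum (H ─ u)) ⟩
    ∑ (λ v → degSum (H ─ (f ⟨$⟩ʳ v)))       ≡⟨ ∑-cong (λ v → degSum-≃ (deck v)) ⟩
    ∑ (λ v → degSum (G ─ v))                ≡⟨ ∑-cards G ⟨
    suc k * degSum G                        ∎)
    where open ≡-Reasoning

  -- Comparing degree sums of G and of the card G - v isolates deg v.
  deg-preserved : ∀ v → deg H (f ⟨$⟩ʳ v) ≡ deg G v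
  deg-preserved v = double-injective _ _ (+-cancelˡ-≡ (degSum (G ─ v)) _ _ (begin
    degSum (G ─ v) + (deg H w + deg H w)    ≡⟨ cong (_+ (deg H w + deg H w)) (degSum-≃ (deck v)) ⟨
    degSum (H ─ w) + (deg H w + deg H w)    ≡⟨ degSum-delete H w ⟨
    degSum H                                ≡⟨ degSum-preserved ⟩
    degSum G                                ≡⟨ degSum-delete G v ⟩
    degSum (G ─ v) + (deg G v + deg G v)    ∎))
    where
    open ≡-Reasoning
    w = f ⟨$⟩ʳ v
    double-injective : ∀ a b → a + a ≡ b + b → a ≡ b
    double-injective a b a+a≡b+b = *-cancelˡ-≡ a b 2
      (trans (cong (a +_) (+-identityʳ a)) (trans a+a≡b+b (cong (b +_) (sym (+-identityʳ b)))))

data Deletion (v : Fin (suc n)) : Fin (suc n) → Set where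
  deleted  : Deletion v v
  survivor : (x : Fin n) → Deletion v (punchIn v x)

deletion : (v y : Fin (suc n)) → Deletion v y
deletion v y with v ≟ y
... | yes refl = deleted
... | no v≢y   = subst (Deletion v) (punchIn-punchOut v≢y) (survivor (punchOut v≢y))

insert-here : (v : Fin (suc n)) (w : Fin (suc m)) (π : Permutation n m) → insert v w π ⟨$⟩ʳ v ≡ w
insert-here v w π with v ≟ v
... | yes _  = refl
... | no v≢v = ⊥-elim (v≢v refl)

Matches : (G H : Graph (suc n)) (v w : Fin (suc n)) → (G ─ v) ≃ (H ─ w) → Fin n → Set
Matches G H v w g x = Adj H w (punchIn w (perm g ⟨$⟩ʳ x)) ≡ Adj G v (punchIn v x)

extend : (G H : Graph (suc n)) (v w : Fin (suc n)) (g : (G ─ v) ≃ (H ─ w)) →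
         (∀ x → Matches G H v w g x) → G ≃ H
extend G H v w g matches = record { perm = ρ ; adj = adj′ }
  where
  ρ = insert v w (perm g)
  ρ-v : ρ ⟨$⟩ʳ v ≡ w
  ρ-v = insert-here v w (perm g)
  ρ-survivor : ∀ x → ρ ⟨$⟩ʳ punchIn v x ≡ punchIn w (perm g ⟨$⟩ʳ x)
  ρ-survivor = insert-punchIn v w (perm g)
  adj′ : ∀ y₁ y₂ → Adj G y₁ y₂ ≡ Adj H (ρ ⟨$⟩ʳ y₁) (ρ ⟨$⟩ʳ y₂)
  adj′ y₁ y₂ with deletion v y₁ | deletion v y₂
  ... | deleted    | deleted    rewrite ρ-v = trans (adj-irrefl G v) (sym (adj-irrefl H w))
  ... | deleted    | survivor x rewrite ρ-v | ρ-survivor x = sym (matches x)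
  ... | survivor x | deleted    rewrite ρ-v | ρ-survivor x =
    trans (adj-sym G _ v) (trans (sym (matches x)) (adj-sym H w _))
  ... | survivor x | survivor y rewrite ρ-survivor x | ρ-survivor y = adj g x y

-- The degree of y reveals whether y is adjacent to v: no vertex of G has
-- the degree y would have if that adjacency were flipped.
DegreeDetects : Graph n → Fin n → Fin n → Set
DegreeDetects G v y = ∀ z → (Adj G v y ≡ true  → suc (deg G z) ≢ deg G y)
                          × (Adj G v y ≡ false → deg G z ≢ suc (deg G y))

indicators-agree : (a b : Bool) {dz dy e : ℕ} → dz ≡ ι a + e → dy ≡ ι b + e →
                   (b ≡ true → suc dz ≢ dy) → (b ≡ false → dz ≢ suc dy) → a ≡ b
indicators-agree true  true  _   _   _   _   = refl
indicators-agree false false _   _   _   _   = refl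
indicators-agree true  false dz≡ dy≡ _   gap = ⊥-elim (gap refl (trans dz≡ (cong suc (sym dy≡))))
indicators-agree false true  dz≡ dy≡ gap _   = ⊥-elim (gap refl (trans (cong suc dz≡) (sym dy≡)))

-- If H has the degrees of G (along f), a card isomorphism at v matches at
-- every survivor whose adjacency to v is detected by its degree: the image
-- u of the survivor has degree ι (w ~ u) + d in H, which is a degree of G.
detected-matches : (G H : Graph (suc n)) (f : Permutation (suc n) (suc n)) →
  (∀ u → deg H (f ⟨$⟩ʳ u) ≡ deg G u) → (v : Fin (suc n)) (g : (G ─ v) ≃ (H ─ (f ⟨$⟩ʳ v))) →
  (x : Fin n) → DegreeDetects G v (punchIn v x) → Matches G H v (f ⟨$⟩ʳ v) g x
detected-matches G H f deg-f v g x detects =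
  indicators-agree _ _ deg-z (deg-survivor G v x) (proj₁ (detects z)) (proj₂ (detects z))
  where
  w = f ⟨$⟩ʳ v
  u = punchIn w (perm g ⟨$⟩ʳ x)
  z = f ⟨$⟩ˡ u
  deg-z : deg G z ≡ ι (Adj H w u) + deg (G ─ v) x
  deg-z = begin
    deg G z                                          ≡⟨ deg-f z ⟨
    deg H (f ⟨$⟩ʳ z)                                 ≡⟨ cong (deg H) (inverseʳ f) ⟩
    deg H u                                          ≡⟨ deg-survivor H w _ ⟩
    ι (Adj H w u) + deg (H ─ w) (perm g ⟨$⟩ʳ x)      ≡⟨ cong (ι (Adj H w u) +_) (deg-≃ g x) ⟩
    ι (Adj H w u) + deg (G ─ v) x                    ∎
    where open ≡-Reasoning

-- Since w and v have the same degree, a card isomorphism that matches at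
-- all survivors but one matches at that one too.
matches-but-one : (G H : Graph (suc n)) (v w : Fin (suc n)) (g : (G ─ v) ≃ (H ─ w)) →
  deg H w ≡ deg G v → (c : Fin n) → (∀ x → x ≢ c → Matches G H v w g x) → ∀ x → Matches G H v w g x
matches-but-one {zero}  _ _ _ _ _ _ () _ _
matches-but-one {suc n} G H v w g deg-w c matches x with x ≟ c
... | no x≢c  = matches x x≢c
... | yes refl = ι-injective (+-cancelʳ-≡ rest _ _ (begin
  ι (hH c) + rest                             ≡⟨ cong (ι (hH c) +_) rest-agrees ⟩
  ι (hH c) + ∑ (λ x → ι (hH (punchIn c x)))   ≡⟨ ∑-remove c (λ x → ι (hH x)) ⟨
  ∑ (λ x → ι (hH x))                          ≡⟨ ∑-permute (perm g) (λ y → ι (Adj H w (punchIn w y))) ⟨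
  ∑ (λ x → ι (Adj H w (punchIn w x)))         ≡⟨ deg-of-deleted H w ⟨
  deg H w                                     ≡⟨ deg-w ⟩
  deg G v                                     ≡⟨ deg-of-deleted G v ⟩
  ∑ (λ x → ι (hG x))                          ≡⟨ ∑-remove c (λ x → ι (hG x)) ⟩
  ι (hG c) + rest                             ∎))
  where
  open ≡-Reasoning
  hH hG : Fin (suc n) → Bool
  hH x = Adj H w (punchIn w (perm g ⟨$⟩ʳ x))
  hG x = Adj G v (punchIn v x)
  rest : ℕ
  rest = ∑ (λ x → ι (hG (punchIn c x)))
  rest-agrees : rest ≡ ∑ (λ x → ι (hH (punchIn c x)))
  rest-agrees = ∑-cong (λ x → cong ι (sym (matches (punchIn c x) (punchInᵢ≢i c x))))

Twins : Graph n → Fin n → Fin n → Set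
Twins K a b = ∀ c → c ≢ a → c ≢ b → Adj K a c ≡ Adj K b c

data Position (a b : Fin n) : Fin n → Set where
  at-a      : Position a b a
  at-b      : Position a b b
  elsewhere : ∀ {c} → c ≢ a → c ≢ b → Position a b c

position : (a b c : Fin n) → Position a b c
position a b c with c ≟ a | c ≟ b
... | yes refl | _        = at-a
... | no _     | yes refl = at-b
... | no c≢a   | no c≢b   = elsewhere c≢a c≢b

module _ (a b : Fin n) where

  transpose-a : transpose a b ⟨$⟩ʳ a ≡ b
  transpose-a rewrite dec-true (a ≟ a) refl = refl

  transpose-b : transpose a b ⟨$⟩ʳ b ≡ a
  transpose-b with b ≟ a
  ... | yes b≡a = b≡a
  ... | no _ rewrite dec-true (b ≟ b) refl = refl

  transpose-elsewhere : ∀ {c} → c ≢ a → c ≢ b → transpose a b ⟨$⟩ʳ c ≡ c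
  transpose-elsewhere {c} c≢a c≢b rewrite dec-false (c ≟ a) c≢a | dec-false (c ≟ b) c≢b = refl

twin-swap : (K : Graph n) {a b : Fin n} → Twins K a b → K ≃ K
twin-swap K {a} {b} twins = record { perm = transpose a b ; adj = adj′ }
  where
  τa = transpose-a a b
  τb = transpose-b a b
  τc = transpose-elsewhere a b
  adj′ : ∀ x y → Adj K x y ≡ Adj K (transpose a b ⟨$⟩ʳ x) (transpose a b ⟨$⟩ʳ y)
  adj′ x y with position a b x | position a b y
  ... | at-a | at-a rewrite τa = trans (adj-irrefl K a) (sym (adj-irrefl K b))
  ... | at-a | at-b rewrite τa | τb = adj-sym K a b
  ... | at-a | elsewhere c≢a c≢b rewrite τa | τc c≢a c≢b = twins y c≢a c≢b
  ... | at-b | at-a rewrite τa | τb = adj-sym K b a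
  ... | at-b | at-b rewrite τb = trans (adj-irrefl K b) (sym (adj-irrefl K a))
  ... | at-b | elsewhere c≢a c≢b rewrite τb | τc c≢a c≢b = sym (twins y c≢a c≢b)
  ... | elsewhere c≢a c≢b | at-a rewrite τa | τc c≢a c≢b =
    trans (adj-sym K x a) (trans (twins x c≢a c≢b) (adj-sym K b x))
  ... | elsewhere c≢a c≢b | at-b rewrite τb | τc c≢a c≢b =
    trans (adj-sym K x b) (trans (sym (twins x c≢a c≢b)) (adj-sym K a x))
  ... | elsewhere c≢a c≢b | elsewhere d≢a d≢b rewrite τc c≢a c≢b | τc d≢a d≢b = refl

≢-≢⇒≡ : {p q r : Bool} → p ≢ q → q ≢ r → p ≡ r
≢-≢⇒≡ {true}  {true}          p≢q _   = ⊥-elim (p≢q refl)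
≢-≢⇒≡ {false} {false}         p≢q _   = ⊥-elim (p≢q refl)
≢-≢⇒≡ {_}     {true}  {true}  _   q≢r = ⊥-elim (q≢r refl)
≢-≢⇒≡ {_}     {false} {false} _   q≢r = ⊥-elim (q≢r refl)
≢-≢⇒≡ {true}  {false} {true}  _   _   = refl
≢-≢⇒≡ {false} {true}  {false} _   _   = refl

-- Suppose g matches everywhere except possibly at two twins a, b of G - v
-- that v distinguishes. Then g, or g composed with the swap of a and b,
-- matches at all but one survivor, hence everywhere, and extends.
twins-extend : (G H : Graph (suc n)) (v w : Fin (suc n)) (g : (G ─ v) ≃ (H ─ w)) →
  deg H w ≡ deg G v → {a b : Fin n} → Twins (G ─ v) a b →
  Adj G v (punchIn v a) ≢ Adj G v (punchIn v b) →
  (∀ x → x ≢ a → x ≢ b → Matches G H v w g x) → G ≃ H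
twins-extend G H v w g deg-w {a} {b} twins distinguishes matches
  with Adj H w (punchIn w (perm g ⟨$⟩ʳ a)) Bool.≟ Adj G v (punchIn v a)
... | yes matches-a = extend G H v w g (matches-but-one G H v w g deg-w b matches-off-b)
  where
  matches-off-b : ∀ x → x ≢ b → Matches G H v w g x
  matches-off-b x x≢b with x ≟ a
  ... | yes refl = matches-a
  ... | no x≢a   = matches x x≢a x≢b
... | no mismatch-a = extend G H v w g′ (matches-but-one G H v w g′ deg-w a matches-off-a)
  where
  g′ = ≃-trans (twin-swap (G ─ v) twins) g
  matches-off-a : ∀ x → x ≢ a → Matches G H v w g′ x
  matches-off-a x x≢a with x ≟ b
  ... | yes refl rewrite transpose-b a x = ≢-≢⇒≡ mismatch-a distinguishes
  ... | no x≢b   rewrite transpose-elsewhere a b x≢a x≢b = matches x x≢a x≢b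

DegreeGap : Graph n → Set
DegreeGap G = ∀ y z → suc (deg G z) ≢ deg G y

gap⇒detects : {G : Graph n} → DegreeGap G → ∀ v y → DegreeDetects G v y
gap⇒detects gap v y z = (λ _ → gap y z) , (λ _ e → gap z y (sym e))

-- Such a graph on at least three vertices is reconstructible: every card
-- isomorphism respects adjacency to the deleted vertex, so any one extends.
gap-reconstructible : ∀ {k} (G H : Graph (3 + k)) (f : Permutation (3 + k) (3 + k)) →
  (∀ v → (G ─ v) ≃ (H ─ (f ⟨$⟩ʳ v))) → DegreeGap G → G ≃ H
gap-reconstructible G H f deck gap = extend G H zero (f ⟨$⟩ʳ zero) (deck zero) (λ x →
  detected-matches G H f (Kelly.deg-preserved G H f deck) zero (deck zero) x (gap⇒detects {G = G} gap zero _))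

different-sides : (inA : Fin n → Bool) {x y : Fin n} → inA x ≡ true → inA y ≡ false → x ≢ y
different-sides inA x∈A y∈B refl = true≢false (trans (sym x∈A) y∈B)

-- A thin spider, described by its body indicator inA and the involution
-- `partner` that exchanges each leg with the body vertex it hangs from.
record ThinSpider (G : Graph n) : Set where
  field
    inA                : Fin n → Bool
    partner            : Fin n → Fin n
    partner-involutive : ∀ x → partner (partner x) ≡ x
    partner-side       : ∀ x → inA (partner x) ≡ not (inA x)
    body-clique        : ∀ x y → inA x ≡ true → inA y ≡ true → x ≢ y → Adj G x y ≡ true
    leg-adjacency      : ∀ x y → inA x ≡ false → Adj G x y ≡ (y ≡ᵇ partner x)

module ThinSpiderFacts {G : Graph n} (S : ThinSpider G) where
  open ThinSpider S

  bodySize : ℕ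
  bodySize = ∑ (λ y → ι (inA y))

  partner-of-body : ∀ {x} → inA x ≡ true → inA (partner x) ≡ false
  partner-of-body {x} x∈A = trans (partner-side x) (cong not x∈A)

  partner-of-leg : ∀ {x} → inA x ≡ false → inA (partner x) ≡ true
  partner-of-leg {x} x∈B = trans (partner-side x) (cong not x∈B)

  partner-injective : ∀ {x y} → partner x ≡ partner y → x ≡ y
  partner-injective {x} {y} eq =
    trans (sym (partner-involutive x)) (trans (cong partner eq) (partner-involutive y))

  body-leg-adjacency : ∀ {x y} → inA x ≡ true → inA y ≡ false → Adj G x y ≡ (y ≡ᵇ partner x)
  body-leg-adjacency {x} {y} x∈A y∈B = begin
    Adj G x y           ≡⟨ adj-sym G x y ⟩
    Adj G y x           ≡⟨ leg-adjacency y x y∈B ⟩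
    (x ≡ᵇ partner y)    ≡⟨ ≡ᵇ-⇔ (λ x≡py → sym (trans (cong partner x≡py) (partner-involutive y)))
                                (λ y≡px → sym (trans (cong partner y≡px) (partner-involutive x))) ⟩
    (y ≡ᵇ partner x)    ∎
    where open ≡-Reasoning

  deg-leg : ∀ {x} → inA x ≡ false → deg G x ≡ 1
  deg-leg {x} x∈B = trans (∑-cong (λ y → cong ι (leg-adjacency x y x∈B))) (∑-point (partner x))

  -- Pointwise, the closed neighbourhood of a body vertex x is A ∪ {partner x}.
  closed-neighbourhood : ∀ {x} → inA x ≡ true → ∀ y →
    ι (Adj G x y) + ι (y ≡ᵇ x) ≡ ι (inA y) + ι (y ≡ᵇ partner x)
  closed-neighbourhood {x} x∈A y with inA y in y∈A | x ≟ y
  ... | false | _ rewrite body-leg-adjacency x∈A y∈A | ≡ᵇ-≢ (different-sides inA x∈A y∈A ∘ sym) =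
    +-comm _ 0
  ... | true | yes refl rewrite adj-irrefl G x | ≡ᵇ-refl x | ≡ᵇ-≢ (different-sides inA x∈A (partner-of-body x∈A)) =
    refl
  ... | true | no x≢y rewrite body-clique x y x∈A y∈A x≢y | ≡ᵇ-≢ (x≢y ∘ sym)
                            | ≡ᵇ-≢ (different-sides inA y∈A (partner-of-body x∈A)) = refl

  -- Summing closed-neighbourhood: a body vertex has degree |A|.
  deg-body : ∀ {x} → inA x ≡ true → deg G x ≡ bodySize
  deg-body {x} x∈A = +-cancelʳ-≡ 1 _ _ (begin
    deg G x + 1                                           ≡⟨ cong (deg G x +_) (∑-point x) ⟨
    deg G x + ∑ (λ y → ι (y ≡ᵇ x))                        ≡⟨ ∑-+ (λ y → ι (Adj G x y)) _ ⟨
    ∑ (λ y → ι (Adj G x y) + ι (y ≡ᵇ x))                  ≡⟨ ∑-cong (closed-neighbourhood x∈A) ⟩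
    ∑ (λ y → ι (inA y) + ι (y ≡ᵇ partner x))              ≡⟨ ∑-+ (λ y → ι (inA y)) _ ⟩
    bodySize + ∑ (λ y → ι (y ≡ᵇ partner x))               ≡⟨ cong (bodySize +_) (∑-point (partner x)) ⟩
    bodySize + 1                                          ∎)
    where open ≡-Reasoning

  degrees : ∀ z → deg G z ≡ 1 ⊎ deg G z ≡ bodySize
  degrees z with inA z in side
  ... | true  = inj₂ (deg-body side)
  ... | false = inj₁ (deg-leg side)

  body-vertex : Fin n → ∃ λ v → inA v ≡ true
  body-vertex x with inA x in x∈A
  ... | true  = x , x∈A
  ... | false = partner x , partner-of-leg x∈A

  bodySize≢0 : Fin n → bodySize ≢ 0
  bodySize≢0 x size≡0 with v , v∈A ← body-vertex x
    with () ← trans (cong ι (sym v∈A)) (∑≡0⇒≡0 (λ y → ι (inA y)) size≡0 v)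

  no-isolated : Fin n → ∀ z → deg G z ≢ 0
  no-isolated x z with degrees z
  ... | inj₁ dz = λ dz≡0 → 1+n≢0 (trans (sym dz) dz≡0)
  ... | inj₂ dz = λ dz≡0 → bodySize≢0 x (trans (sym dz) dz≡0)

  degree-gap : Fin n → bodySize ≢ 2 → DegreeGap G
  degree-gap x size≢2 y z dz+1≡dy with degrees y | degrees z
  ... | inj₁ dy | inj₁ dz with () ← trans (cong suc (sym dz)) (trans dz+1≡dy dy)
  ... | inj₁ dy | inj₂ dz = bodySize≢0 x (suc-injective (trans (cong suc (sym dz)) (trans dz+1≡dy dy)))
  ... | inj₂ dy | inj₁ dz = size≢2 (sym (trans (cong suc (sym dz)) (trans dz+1≡dy dy)))
  ... | inj₂ dy | inj₂ dz = 1+n≢n (trans (cong suc (sym dz)) (trans dz+1≡dy dy))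

-- The exceptional thin spider with |A| = 2 is the path b₁ v a₂ b₂.  In the
-- card at v the degrees no longer tell which of a₂, b₂ is adjacent to v,
-- but a₂ and b₂ are twins in G - v, which resolves the ambiguity.
module PathOnFourVertices {k : ℕ} (G H : Graph (3 + k)) (f : Permutation (3 + k) (3 + k))
  (deck : ∀ v → (G ─ v) ≃ (H ─ (f ⟨$⟩ʳ v))) (S : ThinSpider G)
  (size≡2 : ThinSpiderFacts.bodySize S ≡ 2) where
  open ThinSpider S
  open ThinSpiderFacts S
  open ≡-Reasoning

  v : Fin (3 + k)
  v = proj₁ (body-vertex zero)

  v∈A : inA v ≡ true
  v∈A = proj₂ (body-vertex zero)

  one-more-body : ∑ (λ x → ι (inA (punchIn v x))) ≡ 1
  one-more-body = +-cancelˡ-≡ 1 _ _ (begin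
    1 + ∑ (λ x → ι (inA (punchIn v x)))          ≡⟨ cong (λ b → ι b + ∑ (λ x → ι (inA (punchIn v x)))) v∈A ⟨
    ι (inA v) + ∑ (λ x → ι (inA (punchIn v x)))  ≡⟨ ∑-remove v (λ y → ι (inA y)) ⟨
    bodySize                                     ≡⟨ size≡2 ⟩
    2                                            ∎)

  second-body : ∃ λ xa → inA (punchIn v xa) ≡ true × (∀ x → inA (punchIn v x) ≡ true → x ≡ xa)
  second-body = ∑ι≡1⇒unique (λ x → inA (punchIn v x)) one-more-body

  xa : Fin (2 + k)
  xa = proj₁ second-body

  a₂ b₁ b₂ : Fin (3 + k)
  a₂ = punchIn v xa
  b₁ = partner v
  b₂ = partner a₂

  a₂∈A : inA a₂ ≡ true
  a₂∈A = proj₁ (proj₂ second-body)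

  body : ∀ y → inA y ≡ true → y ≡ v ⊎ y ≡ a₂
  body y y∈A with deletion v y
  ... | deleted    = inj₁ refl
  ... | survivor x = inj₂ (cong (punchIn v) (proj₂ (proj₂ second-body) x y∈A))

  xb₁ xb : Fin (2 + k)
  xb₁ = punchOut (different-sides inA v∈A (partner-of-body v∈A))
  xb  = punchOut (different-sides inA v∈A (partner-of-body a₂∈A))

  at-b₁ : punchIn v xb₁ ≡ b₁
  at-b₁ = punchIn-punchOut _

  at-b₂ : punchIn v xb ≡ b₂
  at-b₂ = punchIn-punchOut _

  partner-flip : ∀ {y c} → partner y ≡ c → y ≡ partner c
  partner-flip {y} eq = trans (sym (partner-involutive y)) (cong partner eq)

  only-b₁ : ∀ x → x ≢ xa → x ≢ xb → x ≡ xb₁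
  only-b₁ x x≢xa x≢xb with inA (punchIn v x) in side
  ... | true with body _ side
  ...   | inj₁ eq = ⊥-elim (punchInᵢ≢i v x eq)
  ...   | inj₂ eq = ⊥-elim (x≢xa (punchIn-injective v x xa eq))
  only-b₁ x x≢xa x≢xb | false with body _ (partner-of-leg side)
  ...   | inj₁ eq = punchIn-injective v x xb₁ (trans (partner-flip eq) (sym at-b₁))
  ...   | inj₂ eq = ⊥-elim (x≢xb (punchIn-injective v x xb (trans (partner-flip eq) (sym at-b₂))))

  v≢a₂ : v ≢ a₂
  v≢a₂ v≡a₂ = punchInᵢ≢i v xa (sym v≡a₂)

  b₁≢b₂ : b₁ ≢ b₂
  b₁≢b₂ b₁≡b₂ = v≢a₂ (partner-injective b₁≡b₂)

  v~b₁ : Adj G v b₁ ≡ true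
  v~b₁ = trans (body-leg-adjacency v∈A (partner-of-body v∈A)) (≡ᵇ-refl b₁)

  -- a₂ and b₂ are both non-adjacent to b₁, the only other survivor.
  twins : Twins (G ─ v) xa xb
  twins c c≢xa c≢xb rewrite only-b₁ c c≢xa c≢xb | at-b₁ | at-b₂ = begin
    Adj G a₂ b₁        ≡⟨ body-leg-adjacency a₂∈A (partner-of-body v∈A) ⟩
    (b₁ ≡ᵇ b₂)         ≡⟨ ≡ᵇ-≢ b₁≢b₂ ⟩
    false              ≡⟨ ≡ᵇ-≢ (different-sides inA a₂∈A (partner-of-body v∈A) ∘ sym) ⟨
    (b₁ ≡ᵇ a₂)         ≡⟨ cong (b₁ ≡ᵇ_) (partner-involutive a₂) ⟨
    (b₁ ≡ᵇ partner b₂) ≡⟨ leg-adjacency b₂ b₁ (partner-of-body a₂∈A) ⟨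
    Adj G b₂ b₁        ∎

  distinguishes : Adj G v a₂ ≢ Adj G v (punchIn v xb)
  distinguishes v~a₂≡v~b₂ with () ← begin
    true                   ≡⟨ body-clique v a₂ v∈A a₂∈A v≢a₂ ⟨
    Adj G v a₂             ≡⟨ v~a₂≡v~b₂ ⟩
    Adj G v (punchIn v xb) ≡⟨ cong (Adj G v) at-b₂ ⟩
    Adj G v b₂             ≡⟨ body-leg-adjacency v∈A (partner-of-body a₂∈A) ⟩
    (b₂ ≡ᵇ b₁)             ≡⟨ ≡ᵇ-≢ (b₁≢b₂ ∘ sym) ⟩
    false                  ∎

  -- b₁ is a leg of degree 1 and G has no isolated vertex, so the degree of
  -- b₁ reveals its adjacency to v.
  b₁-detected : DegreeDetects G v b₁
  b₁-detected z = (λ _ dz+1≡1 → no-isolated v z (suc-injective (trans dz+1≡1 (deg-leg (partner-of-body v∈A)))))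
                , (λ v≁b₁ → ⊥-elim (true≢false (trans (sym v~b₁) v≁b₁)))

  -- The card isomorphism at v matches at b₁, the only survivor besides the
  -- twins a₂, b₂ that v distinguishes.
  reconstruct : G ≃ H
  reconstruct = twins-extend G H v (f ⟨$⟩ʳ v) (deck v) (deg-preserved v) twins distinguishes matches-at-b₁
    where
    open Kelly G H f deck
    matches-at-b₁ : ∀ x → x ≢ xa → x ≢ xb → Matches G H v (f ⟨$⟩ʳ v) (deck v) x
    matches-at-b₁ x x≢xa x≢xb rewrite only-b₁ x x≢xa x≢xb =
      detected-matches G H f deg-preserved v (deck v) xb₁ (subst (DegreeDetects G v) (sym at-b₁) b₁-detected)

thin-reconstructible : ∀ {k} (G H : Graph (3 + k)) (f : Permutation (3 + k) (3 + k)) →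
  (∀ v → (G ─ v) ≃ (H ─ (f ⟨$⟩ʳ v))) → ThinSpider G → G ≃ H
thin-reconstructible G H f deck S with ThinSpiderFacts.bodySize S Nat.≟ 2
... | yes size≡2 = PathOnFourVertices.reconstruct G H f deck S size≡2
... | no  size≢2 = gap-reconstructible G H f deck (ThinSpiderFacts.degree-gap S zero size≢2)

complement : Graph n → Graph n
Adj        (complement G) x y = if x ≡ᵇ y then false else not (Adj G x y)
adj-sym    (complement G) x y = cong₂ (λ b c → if b then false else not c) (≡ᵇ-⇔ {x = x} {y} sym sym) (adj-sym G x y)
adj-irrefl (complement G) x   = cong (λ b → if b then false else not (Adj G x x)) (≡ᵇ-refl x)

complement-≃ : {G : Graph n} {H : Graph m} → G ≃ H → complement G ≃ complement H
complement-≃ {G = G} {H} g = record { perm = perm g ; adj = λ x y →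
  cong₂ (λ b c → if b then false else not c) (≡ᵇ-⇔ (cong (perm g ⟨$⟩ʳ_)) (perm-injective x y)) (adj g x y) }
  where
  perm-injective : ∀ x y → perm g ⟨$⟩ʳ x ≡ perm g ⟨$⟩ʳ y → x ≡ y
  perm-injective x y eq = trans (sym (inverseˡ (perm g))) (trans (cong (perm g ⟨$⟩ˡ_) eq) (inverseˡ (perm g)))

complement-─ : (G : Graph (suc n)) (v : Fin (suc n)) → complement (G ─ v) ≃ (complement G ─ v)
complement-─ G v = record { perm = Perm.id ; adj = λ x y →
  cong (λ b → if b then false else not (Adj G (punchIn v x) (punchIn v y)))
       (≡ᵇ-⇔ (cong (punchIn v)) (punchIn-injective v x y)) }

complement-involutive : (G : Graph n) → complement (complement G) ≃ G
complement-involutive G = record { perm = Perm.id ; adj = adj′ }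
  where
  adj′ : ∀ x y → Adj (complement (complement G)) x y ≡ Adj G x y
  adj′ x y with x ≟ y
  ... | yes refl = sym (adj-irrefl G x)
  ... | no _     = Bool.not-involutive (Adj G x y)

uncomplement : {G : Graph n} {H : Graph m} → complement G ≃ complement H → G ≃ H
uncomplement {G = G} {H} g =
  ≃-trans (≃-sym (complement-involutive G)) (≃-trans (complement-≃ g) (complement-involutive H))

complement-deck : {G H : Graph (suc n)} (f : Permutation (suc n) (suc n)) →
  (∀ v → (G ─ v) ≃ (H ─ (f ⟨$⟩ʳ v))) → ∀ v → (complement G ─ v) ≃ (complement H ─ (f ⟨$⟩ʳ v))
complement-deck {G = G} {H} f deck v =
  ≃-trans (≃-sym (complement-─ G v)) (≃-trans (complement-≃ (deck v)) (complement-─ H (f ⟨$⟩ʳ v)))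

bool-case : {X : Set} (b : Bool) → (b ≡ true → X) → (b ≡ false → X) → X
bool-case true  t _ = t refl
bool-case false _ e = e refl

bool-case-true : {X : Set} {b : Bool} (b≡true : b ≡ true) (t : b ≡ true → X) (e : b ≡ false → X) →
                 bool-case b t e ≡ t b≡true
bool-case-true refl t e = refl

bool-case-false : {X : Set} {b : Bool} (b≡false : b ≡ false) (t : b ≡ true → X) (e : b ≡ false → X) →
                  bool-case b t e ≡ e b≡false
bool-case-false refl t e = refl

bool-as-≡ᵇ : (b : Bool) {y c : Fin n} → (b ≡ true ⇔ y ≡ c) → b ≡ (y ≡ᵇ c)
bool-as-≡ᵇ true  b⇔y≡c = sym (dec-true (_ ≟ _) (Equivalence.to b⇔y≡c refl))
bool-as-≡ᵇ false b⇔y≡c = sym (dec-false (_ ≟ _) (λ y≡c → true≢false (sym (Equivalence.from b⇔y≡c y≡c))))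

-- The bijection f : B → A of a spider, extended to an involution of V
-- that exchanges each leg b with f b.
module Partner {G : Graph n} (inA : Fin n → Bool) (f : Bset G inA ⤖ Aset G inA) where
  private
    f↔ = ⤖⇒↔ f

  partner : Fin n → Fin n
  partner x = bool-case (inA x) (λ x∈A → proj₁ (Inverse.from f↔ (x , x∈A)))
                                 (λ x∈B → proj₁ (Inverse.to f↔ (x , x∈B)))

  partner-of-body : ∀ {x} (x∈A : inA x ≡ true) → partner x ≡ proj₁ (Inverse.from f↔ (x , x∈A))
  partner-of-body x∈A = bool-case-true x∈A _ _

  partner-of-leg : ∀ {x} (x∈B : inA x ≡ false) → partner x ≡ proj₁ (Bijection.to f (x , x∈B))
  partner-of-leg x∈B = bool-case-false x∈B _ _

  partner-side : ∀ x → inA (partner x) ≡ not (inA x)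
  partner-side x = bool-case (inA x)
    (λ x∈A → trans (cong inA (partner-of-body x∈A)) (trans (proj₂ (Inverse.from f↔ (x , x∈A))) (cong not (sym x∈A))))
    (λ x∈B → trans (cong inA (partner-of-leg x∈B)) (trans (proj₂ (Inverse.to f↔ (x , x∈B))) (cong not (sym x∈B))))

  partner-involutive : ∀ x → partner (partner x) ≡ x
  partner-involutive x = bool-case (inA x)
    (λ x∈A → trans (cong partner (partner-of-body x∈A))
                   (trans (partner-of-leg _) (cong proj₁ (Inverse.strictlyInverseˡ f↔ (x , x∈A)))))
    (λ x∈B → trans (cong partner (partner-of-leg x∈B))
                   (trans (partner-of-body _) (cong proj₁ (Inverse.strictlyInverseʳ f↔ (x , x∈B)))))

thin⇒ThinSpider : {G : Graph n} (inA : Fin n → Bool) → IsSplitPartition G inA →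
  (f : Bset G inA ⤖ Aset G inA) → ThinLegs G inA f → ThinSpider G
thin⇒ThinSpider {G = G} inA (clique , _) f legs = record
  { inA                = inA
  ; partner            = partner
  ; partner-involutive = partner-involutive
  ; partner-side       = partner-side
  ; body-clique        = λ x y x∈A y∈A x≢y → clique (x , x∈A) (y , y∈A) x≢y
  ; leg-adjacency      = λ x y x∈B →
      trans (bool-as-≡ᵇ (Adj G x y) (legs (x , x∈B) y)) (cong (y ≡ᵇ_) (sym (partner-of-leg x∈B)))
  }
  where open Partner {G = G} inA f

-- The complement of a thick spider is a thin spider: its body is B, and each
-- body vertex x of G keeps, in the complement, exactly its partner leg.
module ThickComplement {G : Graph n} (inA : Fin n → Bool) (split : IsSplitPartition G inA)
                       (f : Bset G inA ⤖ Aset G inA) (legs : ThickLegs G inA f) where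
  open Partner {G = G} inA f

  private
    not-move : ∀ {b c} → not b ≡ c → b ≡ not c
    not-move {b} e = trans (sym (Bool.not-involutive b)) (cong not e)

    partner-of-body-is-leg : ∀ {x} → inA x ≡ true → inA (partner x) ≡ false
    partner-of-body-is-leg {x} x∈A = trans (partner-side x) (cong not x∈A)

    partner-symmetric : ∀ {x y} → (x ≡ᵇ partner y) ≡ (y ≡ᵇ partner x)
    partner-symmetric {x} {y} = ≡ᵇ-⇔ (λ x≡py → sym (trans (cong partner x≡py) (partner-involutive y)))
                                     (λ y≡px → sym (trans (cong partner y≡px) (partner-involutive x)))

  leg-misses-partner : ∀ {x y} → inA x ≡ true → inA y ≡ false → not (Adj G y x) ≡ (x ≡ᵇ partner y)
  leg-misses-partner {x} {y} x∈A y∈B with x ≟ partner y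
  ... | no x≢py = cong not (Equivalence.from (legs (y , y∈B) x) (x∈A , λ x≡fy → x≢py (trans x≡fy (sym (partner-of-leg y∈B)))))
  ... | yes x≡py with Adj G y x in y~x
  ...   | false = refl
  ...   | true  = ⊥-elim (proj₂ (Equivalence.to (legs (y , y∈B) x) y~x) (trans x≡py (partner-of-leg y∈B)))

  complement-leg-adjacency : ∀ x y → not (inA x) ≡ false → Adj (complement G) x y ≡ (y ≡ᵇ partner x)
  complement-leg-adjacency x y x∈A′ with x∈A ← not-move x∈A′ | x ≟ y
  ... | yes refl = sym (≡ᵇ-≢ (different-sides inA x∈A (partner-of-body-is-leg x∈A)))
  ... | no x≢y = bool-case (inA y)
    (λ y∈A → trans (cong not (proj₁ split (x , x∈A) (y , y∈A) x≢y))
                   (sym (≡ᵇ-≢ (different-sides inA y∈A (partner-of-body-is-leg x∈A)))))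
    (λ y∈B → trans (cong not (adj-sym G x y)) (trans (leg-misses-partner x∈A y∈B) (partner-symmetric {x} {y})))

  thinComplement : ThinSpider (complement G)
  thinComplement = record
    { inA                = λ x → not (inA x)
    ; partner            = partner
    ; partner-involutive = partner-involutive
    ; partner-side       = λ x → cong not (partner-side x)
    ; body-clique        = λ x y x∈B y∈B x≢y →
        cong₂ (λ b c → if b then false else not c) (≡ᵇ-≢ x≢y) (proj₂ split (x , not-move x∈B) (y , not-move y∈B))
    ; leg-adjacency      = complement-leg-adjacency
    }

-- Thin spiders directly; thick spiders because their complements are thin
-- and complementation commutes with taking cards.
spider-reconstructible : ∀ {k} (G H : Graph (3 + k)) (f : Permutation (3 + k) (3 + k)) →
  (∀ v → (G ─ v) ≃ (H ─ (f ⟨$⟩ʳ v))) → Spider G → G ≃ H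
spider-reconstructible G H f deck (thin inA split g legs) =
  thin-reconstructible G H f deck (thin⇒ThinSpider inA split g legs)
spider-reconstructible G H f deck (thick inA split g legs) =
  uncomplement (thin-reconstructible (complement G) (complement H) f (complement-deck {G = G} {H} f deck)
                                     (ThickComplement.thinComplement {G = G} inA split g legs))

-- f forces both graphs to have the same number of vertices; the deck
-- hypothesis then makes G ≃ H by spider-reconstructible.
mainTheorem3 : (n m : ℕ) → 2 ≤ n → (G : Graph (suc n)) → Spider G →
    (H : Graph (suc m)) → (f : Fin (suc n) ⤖ Fin (suc m)) →
    ((v : Fin (suc n)) → (G ─ v) ≅ (H ─ Bijection.to f v)) →
    H ≅ G
mainTheorem3 (suc (suc k)) m (s≤s (s≤s z≤n)) G spider H f deck with ↔⇒≡ (⤖⇒↔ f)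
... | refl = ≃⇒≅ (≃-sym (spider-reconstructible G H (⤖⇒↔ f) (λ v → ≅⇒≃ (deck v)) spider))
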